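{- Let $g>0$ with $g\equiv0\pmod{p-1}$ and let $\mathbb F$ be a finite field of characteristic $p$. Then the map $V_g(\mathbb F)\to\mathbb F$, $P(X,Y)\mapsto P(0,1)$, is $S_0(p)$-equivariant (with $S_0(p)$ acting trivially on $\mathbb F$), and thus induces a Hecke-equivariant map $$\alpha:H^1_c(\Gamma_0(N),V_g(\mathbb F))\to H^1_c(\Gamma_0(Np),\mathbb F),$$ where Hecke-equivariance at $p$ means that $\alpha$ intertwines $T_p$ on the source with $U_p$ on the target.
   Context: $p$ odd prime, $p\nmid N$. $V_g(R)$: homogeneous degree-$g$ polynomials in $X,Y$ over $R$ with right action $(P|\gamma)(X,Y)=P(dX-cY,-bX+aY)$ for $\gamma=\begin{pmatrix}a&b\\c&d\end{pmatrix}$. $S_0(p)=\{\begin{pmatrix}a&b\\c&d\end{pmatrix}\in M_2(\mathbb Z):ad-bc\ne0,\ p\mid c,\ p\nmid a\}$. $H^1_c(G,M)$ is identified with additive maps $\varphi:\mathrm{Div}^0(\mathbb P^1(\mathbb Q))\to M$ with $\varphi(\gamma D)|\gamma=\varphi(D)$ for $\gamma\in G$; $\alpha$ is the composite of restriction from $\Gamma_0(N)$ to $\Gamma_0(Np)$ with the map induced on coefficients. -}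

module Defs where

open import Level using (Level; _⊔_) renaming (suc to lsuc)
open import Data.Nat as ℕ using (ℕ; zero; suc; _<_)
open import Data.Nat.Divisibility as ND using ()
open import Data.Integer as ℤ using (ℤ; +_; -[1+_])
open import Data.Integer.Divisibility as ZD using ()
open import Data.Rational as ℚ using (ℚ)
open import Data.Fin as Fin using (Fin)
open import Data.List as List using (List; []; _∷_; _++_)
open import Data.List.Relation.Unary.Any using (Any)
open import Data.Product using (Σ; _×_; _,_; proj₁; proj₂; ∃)
open import Data.Maybe using (Maybe; just; nothing)
open import Relation.Nullary using (¬_; yes; no; Dec)
open import Relation.Nullary.Decidable using (map′)
open import Relation.Binary.PropositionalEquality using (_≡_; _≢_; refl; cong)
open import Relation.Binary.Core using (Rel)
open import Algebra.Bundles using (CommutativeRing)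

record Mat : Set where
  constructor mat
  field a b c d : ℤ
open Mat public

det : Mat → ℤ
det γ = (a γ ℤ.* d γ) ℤ.- (b γ ℤ.* c γ)

Γ₀ : ℕ → Mat → Set
Γ₀ M γ = (det γ ≡ + 1) × (+ M ZD.∣ c γ)

S₀ : ℕ → Mat → Set
S₀ p γ = (det γ ≢ + 0) × (+ p ZD.∣ c γ) × ¬ (+ p ZD.∣ a γ)

module _ {c₀ ℓ} (F : CommutativeRing c₀ ℓ) where
  open CommutativeRing F

  natF : ℕ → Carrier
  natF zero = 0#
  natF (suc n) = 1# + natF n

  intF : ℤ → Carrier
  intF (+ n) = natF n
  intF -[1+ n ] = - natF (suc n)

  record IsFiniteField : Set (c₀ ⊔ ℓ) where
    field
      nontrivial : ¬ (1# ≈ 0#)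
      inverses   : ∀ x → ¬ (x ≈ 0#) → ∃ λ y → (x * y) ≈ 1#
      finite     : Σ (List Carrier) λ xs → ∀ x → Any (x ≈_) xs

  HasCharacteristic : ℕ → Set ℓ
  HasCharacteristic n =
    (0 < n) × (natF n ≈ 0#) × (∀ m → 0 < m → m < n → ¬ (natF m ≈ 0#))

record Coeff (c ℓ : Level) : Set (lsuc (c ⊔ ℓ)) where
  field
    M     : Set c
    _≈_   : Rel M ℓ
    _+_   : M → M → M
    0M    : M
    _∣_   : M → Mat → M

module Poly {c₀ ℓ} (F : CommutativeRing c₀ ℓ) where
  open CommutativeRing F

  -- A homogeneous form in X,Y of some degree n is stored as the list of
  -- its coefficients: position i holds the coefficient of X^i Y^(n-i).
  _⊕_ : List Carrier → List Carrier → List Carrier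
  [] ⊕ q = q
  (x ∷ p) ⊕ [] = x ∷ p
  (x ∷ p) ⊕ (y ∷ q) = (x + y) ∷ (p ⊕ q)

  _⊛_ : List Carrier → List Carrier → List Carrier
  [] ⊛ q = []
  (x ∷ p) ⊛ q = List.map (x *_) q ⊕ (0# ∷ (p ⊛ q))

  pow : List Carrier → ℕ → List Carrier
  pow l zero = 1# ∷ []
  pow l (suc n) = l ⊛ pow l n

  -- the linear form uX + vY
  lin : Carrier → Carrier → List Carrier
  lin u v = v ∷ u ∷ []

  coeffAt : List Carrier → ℕ → Carrier
  coeffAt [] _ = 0#
  coeffAt (x ∷ _) zero = x
  coeffAt (_ ∷ l) (suc i) = coeffAt l i

  sumFin : ∀ {n} → (Fin n → List Carrier) → List Carrier
  sumFin {zero} f = []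
  sumFin {suc n} f = f Fin.zero ⊕ sumFin (λ i → f (Fin.suc i))

  -- V_g(F): homogeneous polynomials of degree g;
  -- P i = coefficient of X^i Y^(g-i)
  Vg : ℕ → Set c₀
  Vg g = Fin (suc g) → Carrier

  -- (P|γ)(X,Y) = P(dX - cY, -bX + aY)
  act : ∀ g → Vg g → Mat → Vg g
  act g P γ j = coeffAt expanded (Fin.toℕ j)
    where
      ι = intF F
      L₁ = lin (ι (d γ)) (- ι (c γ))
      L₂ = lin (- ι (b γ)) (ι (a γ))
      expanded = sumFin {suc g} λ i →
        List.map (P i *_) (pow L₁ (Fin.toℕ i) ⊛ pow L₂ (g ℕ.∸ Fin.toℕ i))

  VgModule : ℕ → Coeff c₀ ℓ
  VgModule g = record
    { M = Vg g
    ; _≈_ = λ P Q → ∀ i → P i ≈ Q i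
    ; _+_ = λ P Q i → P i + Q i
    ; 0M = λ _ → 0#
    ; _∣_ = act g
    }

  trivModule : Coeff c₀ ℓ
  trivModule = record
    { M = Carrier ; _≈_ = _≈_ ; _+_ = _+_ ; 0M = 0# ; _∣_ = λ x _ → x }

  -- the map V_g(F) → F, P ↦ P(0,1)  (coefficient of Y^g)
  ev01 : ∀ g → Vg g → Carrier
  ev01 g P = P Fin.zero

data P1 : Set where
  fin : ℚ → P1
  ∞   : P1

_≟P_ : (x y : P1) → Dec (x ≡ y)
fin r ≟P fin s = map′ (cong fin) (λ { refl → refl }) (r ℚ.≟ s)
fin r ≟P ∞ = no λ ()
∞ ≟P fin s = no λ ()
∞ ≟P ∞ = yes refl

proj : ℤ → ℤ → P1
proj x (+ zero) = ∞
proj x (+ (suc k)) = fin (x ℚ./ suc k)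
proj x -[1+ k ] = fin (ℤ.- x ℚ./ suc k)

_·P_ : Mat → P1 → P1
γ ·P fin r = proj (a γ ℤ.* ℚ.↥ r ℤ.+ b γ ℤ.* ℚ.↧ r) (c γ ℤ.* ℚ.↥ r ℤ.+ d γ ℤ.* ℚ.↧ r)
γ ·P ∞ = proj (a γ) (c γ)

-- divisors on P¹(ℚ) as finite formal sums Σ nᵢ {xᵢ}
Div : Set
Div = List (ℤ × P1)

coeffD : Div → P1 → ℤ
coeffD [] x = + 0
coeffD ((n , y) ∷ D) x with y ≟P x
... | yes _ = n ℤ.+ coeffD D x
... | no _ = coeffD D x

deg : Div → ℤ
deg [] = + 0
deg ((n , _) ∷ D) = n ℤ.+ deg D

_≈D_ : Div → Div → Set
D ≈D E = ∀ x → coeffD D x ≡ coeffD E x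

_·D_ : Mat → Div → Div
γ ·D D = List.map (λ { (n , x) → (n , γ ·P x) }) D

-- H¹_c(G, M) as additive G-equivariant maps Div⁰(P¹(ℚ)) → M.
-- A map is given by its values on all divisors; only values on degree-0
-- divisors matter.

module Coh {c₀ ℓ} (C : Coeff c₀ ℓ) where
  open Coeff C

  IsH1c : (Mat → Set) → (Div → M) → Set ℓ
  IsH1c G φ =
    (∀ D E → deg D ≡ + 0 → deg E ≡ + 0 → φ (D ++ E) ≈ (φ D + φ E)) ×
    (∀ D E → deg D ≡ + 0 → D ≈D E → φ D ≈ φ E) ×
    (∀ γ → G γ → ∀ D → deg D ≡ + 0 → (φ (γ ·D D) ∣ γ) ≈ φ D)

  sumM : List M → M
  sumM [] = 0M
  sumM (x ∷ xs) = x + sumM xs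

  -- coset representatives for Γ₀(L) diag(1,ℓ) Γ₀(L):
  -- (1 a; 0 ℓ) for 0 ≤ a < ℓ, plus (ℓ 0; 0 1) when ℓ ∤ L
  heckeReps : ℕ → ℕ → List Mat
  heckeReps L l = List.map (λ k → mat (+ 1) (+ k) (+ 0) (+ l)) (List.upTo l)
                  ++ extra (l ND.∣? L)
    where
      extra : ∀ {P : Set} → Dec P → List Mat
      extra (yes _) = []
      extra (no _)  = mat (+ l) (+ 0) (+ 0) (+ 1) ∷ []

  -- Hecke operator at the prime l on H¹_c(Γ₀(L), M):
  -- T_l if l ∤ L, U_l if l ∣ L
  hecke : ℕ → ℕ → (Div → M) → (Div → M)
  hecke L l φ D = sumM (List.map (λ δ → φ (δ ·D D) ∣ δ) (heckeReps L l))

module Submission where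

-- P(0,1) is the coefficient of Y^g, and (P|γ)(0,1) = P(-c, a).
-- When p ∣ c this is a^g · P(0,1) in F; when moreover p ∤ a, the element a of F
-- is a nonzero element of a field of characteristic p with a^p = a (Fermat, via
-- the Frobenius identity (1 + y)^p = 1 + y^p), so a^(p-1) = 1 and a^g = 1
-- because (p - 1) ∣ g.
--
-- Cohomology.  Γ₀(Np) lies in Γ₀(N) and in S₀(p), so composing a cocycle with
-- ev gives a cocycle for Γ₀(Np) with trivial coefficients.  For the Hecke
-- operator at a prime l, both sides are sums over coset representatives; the
-- upper-triangular ones (1 k; 0 l) lie in S₀(p), and so does (l 0; 0 1) unless
-- l = p.  The only representative not shared by the two sides is (p 0; 0 1),
-- appearing in T_p but not in U_p, and its term vanishes since it carries the
-- factor p^g = 0 in F.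

open import Defs
open import Data.Nat as ℕ using (ℕ; zero; suc; _<_; _∸_; z≤n; s≤s; _!)
import Data.Nat.Properties as ℕP
import Data.Nat.Divisibility as ℕD
open ℕD using (_∣_; divides; _∣?_)
open import Data.Nat.DivMod using (_%_; _/_; m≡m%n+[m/n]*n; m%n<n; m/n*n≡m)
open import Data.Nat.Primality using (Prime; euclidsLemma; prime⇒nonTrivial; prime⇒irreducible)
open import Data.Nat.Combinatorics using (_C_; nCn≡1; k![n∸k]!∣n!)
open import Data.Nat.Combinatorics.Specification using (nCk≡n!/k![n-k]!)
open import Data.Integer as ℤ using (+_; -[1+_])
import Data.Integer.Properties as ℤP
import Data.Integer.Divisibility.Signed as ℤD
open import Data.Fin as Fin using (Fin; toℕ; inject₁; fromℕ)
import Data.Fin.Properties as FinP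
open import Data.List as List using (List; []; _∷_; _++_)
import Data.List.Properties as ListP
open import Data.List.Relation.Unary.All as All using (All; []; _∷_)
import Data.List.Relation.Unary.All.Properties as AllP
open import Data.Product using (_×_; _,_; proj₁; proj₂)
open import Data.Sum using (inj₁; inj₂)
open import Data.Empty using (⊥-elim)
open import Function using (_∘_)
open import Relation.Nullary using (¬_; yes; no; Dec; contradiction)
open import Relation.Binary.PropositionalEquality as ≡ using (_≡_; _≢_)
open import Algebra.Bundles using (CommutativeRing)

prime>1 : ∀ {p} → Prime p → 1 < p
prime>1 {p} pr = ℕ.nonTrivial⇒n>1 p {{prime⇒nonTrivial pr}}

prime∤1 : ∀ {p} → Prime p → ¬ (p ∣ 1)
prime∤1 pr p∣1 = ℕP.<⇒≢ (prime>1 pr) (≡.sym (ℕD.∣1⇒≡1 p∣1))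

∤-between : ∀ {p m} → 0 < m → m < p → ¬ (p ∣ m)
∤-between {m = suc m} _ m<p p∣m = ℕP.<⇒≱ m<p (ℕD.∣⇒≤ p∣m)

prime∤factorial : ∀ {p} → Prime p → ∀ m → m < p → ¬ (p ∣ m !)
prime∤factorial pr zero _ = prime∤1 pr
prime∤factorial pr (suc m) m<p p∣m! with euclidsLemma (suc m) (m !) pr p∣m!
... | inj₁ p∣1+m = ∤-between (s≤s z≤n) m<p p∣1+m
... | inj₂ p∣m!′ = prime∤factorial pr m (ℕP.<-trans (ℕP.n<1+n m) m<p) p∣m!′

-- p ∣ (p choose k) for 0 < k < p: p divides (p C k)·k!·(p-k)! = p!, but
-- neither k! nor (p-k)!.
prime∣binomial : ∀ {p} → Prime p → ∀ {k} → 0 < k → k < p → p ∣ p C k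
prime∣binomial {suc n} pr {k} 0<k k<p
  with euclidsLemma (p C k) (k ! ℕ.* (p ∸ k) !) pr p∣product
  where
    p = suc n
    k≤p = ℕP.<⇒≤ k<p
    product≡p! : (p C k) ℕ.* (k ! ℕ.* (p ∸ k) !) ≡ p !
    product≡p! = ≡.trans (≡.cong (ℕ._* (k ! ℕ.* (p ∸ k) !)) (nCk≡n!/k![n-k]! k≤p))
                         (m/n*n≡m {{ℕP._!*_!≢0 k (p ∸ k)}} (k![n∸k]!∣n! k≤p))
    p∣product : p ∣ (p C k) ℕ.* (k ! ℕ.* (p ∸ k) !)
    p∣product = ≡.subst (p ∣_) (≡.sym product≡p!) (ℕD.m∣m*n (n !))
... | inj₁ p∣pCk = p∣pCk
... | inj₂ p∣factorials with euclidsLemma (k !) ((suc n ∸ k) !) pr p∣factorials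
...   | inj₁ p∣k! = ⊥-elim (prime∤factorial pr k k<p p∣k!)
...   | inj₂ p∣[p-k]! = ⊥-elim (prime∤factorial pr (suc n ∸ k) (ℕP.∸-monoʳ-< 0<k (ℕP.<⇒≤ k<p)) p∣[p-k]!)

prime∣prime⇒≡ : ∀ {d q} → Prime d → Prime q → d ∣ q → d ≡ q
prime∣prime⇒≡ dp qp d∣q with prime⇒irreducible qp d∣q
... | inj₁ d≡1 = contradiction d≡1 (ℕP.>⇒≢ (prime>1 dp))
... | inj₂ d≡q = d≡q

module CharacteristicP {c₀ ℓ} (F : CommutativeRing c₀ ℓ) where
  open CommutativeRing F
  open import Relation.Binary.Reasoning.Setoid setoid
  open import Algebra.Properties.Semiring.Exp semiring using (_^_; ^-congˡ; ^-assocʳ)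
  open import Algebra.Properties.Semiring.Mult semiring
    using (×-assoc-*; ×1-homo-*; ×-homo-+; ×-congʳ) renaming (_×_ to _×′_)
  open import Algebra.Properties.AbelianGroup +-abelianGroup
    using (ε⁻¹≈ε; inverseʳ-unique; ⁻¹-involutive)
  open import Algebra.Properties.Monoid.Sum +-monoid
    using (sum; sum-cong-≋; sum-replicate-zero; sum-init-last)
  import Algebra.Properties.CommutativeSemiring.Binomial commutativeSemiring as Binomial

  ι : ℤ.ℤ → Carrier
  ι = intF F

  -- natF n is the additive multiple n ×′ 1#, hence a semiring homomorphism.
  natF≈×1 : ∀ n → natF F n ≈ n ×′ 1#
  natF≈×1 zero = refl
  natF≈×1 (suc n) = +-congˡ (natF≈×1 n)

  natF-+ : ∀ m n → natF F (m ℕ.+ n) ≈ natF F m + natF F n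
  natF-+ m n = trans (natF≈×1 (m ℕ.+ n))
    (trans (×-homo-+ 1# m n) (sym (+-cong (natF≈×1 m) (natF≈×1 n))))

  natF-* : ∀ m n → natF F (m ℕ.* n) ≈ natF F m * natF F n
  natF-* m n = trans (natF≈×1 (m ℕ.* n))
    (trans (×1-homo-* m n) (sym (*-cong (natF≈×1 m) (natF≈×1 n))))

  ×≈natF* : ∀ m z → m ×′ z ≈ natF F m * z
  ×≈natF* m z = trans (×-congʳ m (sym (*-identityˡ z)))
    (trans (sym (×-assoc-* m 1# z)) (*-congʳ (sym (natF≈×1 m))))

  1#^ : ∀ n → 1# ^ n ≈ 1#
  1#^ zero = refl
  1#^ (suc n) = trans (*-identityˡ _) (1#^ n)

  sum-zero : ∀ {n} (t : Fin n → Carrier) → (∀ i → t i ≈ 0#) → sum t ≈ 0#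
  sum-zero {n} t t≈0 = trans (sum-cong-≋ t≈0) (sum-replicate-zero n)

  sum-ends : ∀ n (t : Fin (suc (suc n)) → Carrier) →
             (∀ i → t (Fin.suc (inject₁ i)) ≈ 0#) → sum t ≈ t Fin.zero + t (fromℕ (suc n))
  sum-ends n t interior≈0 = +-congˡ (begin
    sum (t ∘ Fin.suc)                               ≈⟨ sum-init-last (t ∘ Fin.suc) ⟩
    sum (t ∘ Fin.suc ∘ inject₁) + t (fromℕ (suc n)) ≈⟨ +-congʳ (sum-zero _ interior≈0) ⟩
    0# + t (fromℕ (suc n))                          ≈⟨ +-identityˡ _ ⟩
    t (fromℕ (suc n))                               ∎)

  unit-power : ∀ p x y → x ^ p ≈ x → x * y ≈ 1# → x ^ (p ∸ 1) ≈ 1#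
  unit-power zero x y _ _ = refl
  unit-power (suc n) x y x^p≈x xy≈1 = begin
    x ^ n             ≈⟨ sym (*-identityʳ _) ⟩
    x ^ n * 1#        ≈⟨ *-congˡ (sym xy≈1) ⟩
    x ^ n * (x * y)   ≈⟨ sym (*-assoc _ _ _) ⟩
    (x ^ n * x) * y   ≈⟨ *-congʳ (trans (*-comm _ _) x^p≈x) ⟩
    x * y             ≈⟨ xy≈1 ⟩
    1#                ∎

  power-multiple : ∀ x m g → x ^ m ≈ 1# → m ∣ g → x ^ g ≈ 1#
  power-multiple x m _ x^m≈1 (divides q ≡.refl) = begin
    x ^ (q ℕ.* m)   ≡⟨ ≡.cong (x ^_) (ℕP.*-comm q m) ⟩
    x ^ (m ℕ.* q)   ≈⟨ sym (^-assocʳ x m q) ⟩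
    (x ^ m) ^ q     ≈⟨ ^-congˡ q x^m≈1 ⟩
    1# ^ q          ≈⟨ 1#^ q ⟩
    1#              ∎

  natF-vanish : ∀ {p} → natF F p ≈ 0# → ∀ m → p ∣ m → natF F m ≈ 0#
  natF-vanish {p} p≈0 _ (divides q ≡.refl) =
    trans (natF-* q p) (trans (*-congˡ p≈0) (zeroʳ _))

  ι-vanish : ∀ {p} → natF F p ≈ 0# → ∀ a → p ∣ ℤ.∣ a ∣ → ι a ≈ 0#
  ι-vanish p≈0 (+ m) p∣m = natF-vanish p≈0 m p∣m
  ι-vanish p≈0 -[1+ m ] p∣m = trans (-‿cong (natF-vanish p≈0 (suc m) p∣m)) ε⁻¹≈ε

  ×-vanish : ∀ {p} → natF F p ≈ 0# → ∀ m z → p ∣ m → m ×′ z ≈ 0#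
  ×-vanish p≈0 m z p∣m =
    trans (×≈natF* m z) (trans (*-congʳ (natF-vanish p≈0 m p∣m)) (zeroˡ z))

  -- Frobenius: the middle binomial coefficients of (1 + y)^p vanish in F.
  frobenius : ∀ {p} → Prime p → natF F p ≈ 0# → ∀ y → (1# + y) ^ p ≈ 1# + y ^ p
  frobenius {suc n} pr p≈0 y = begin
    (1# + y) ^ suc n                      ≈⟨ Binomial.theorem (suc n) 1# y ⟩
    Binomial.binomialExpansion 1# y (suc n) ≈⟨ sum-ends n term interior≈0 ⟩
    term Fin.zero + term (fromℕ (suc n))  ≈⟨ +-cong first≈y^p last≈1 ⟩
    y ^ suc n + 1#                        ≈⟨ +-comm _ _ ⟩
    1# + y ^ suc n                        ∎
    where
      term = Binomial.binomialTerm 1# y (suc n)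
      interior≈0 : ∀ i → term (Fin.suc (inject₁ i)) ≈ 0#
      interior≈0 i = ×-vanish p≈0 _ _ (prime∣binomial pr (s≤s z≤n)
        (s≤s (≡.subst (_< n) (≡.sym (FinP.toℕ-inject₁ i)) (FinP.toℕ<n i))))
      first≈y^p : term Fin.zero ≈ y ^ suc n
      first≈y^p = trans (+-identityʳ _) (*-identityˡ _)
      last≈1 : term (fromℕ (suc n)) ≈ 1#
      last≈1 = begin
        term (fromℕ (suc n))
          ≡⟨ ≡.cong (λ k → (suc n C k) ×′ (1# ^ k * y ^ (suc n ∸ k))) (FinP.toℕ-fromℕ (suc n)) ⟩
        (suc n C suc n) ×′ (1# ^ suc n * y ^ (suc n ∸ suc n))
          ≡⟨ ≡.cong₂ (λ m e → m ×′ (1# ^ suc n * y ^ e)) (nCn≡1 (suc n)) (ℕP.n∸n≡0 (suc n)) ⟩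
        1 ×′ (1# ^ suc n * 1#)
          ≈⟨ trans (+-identityʳ _) (trans (*-identityʳ _) (1#^ (suc n))) ⟩
        1# ∎

  -- Fermat's little theorem on the image of ℕ, by induction via Frobenius.
  fermat-natF : ∀ {p} → Prime p → natF F p ≈ 0# → ∀ m → natF F m ^ p ≈ natF F m
  fermat-natF {suc n} pr p≈0 zero = zeroˡ _
  fermat-natF pr p≈0 (suc m) =
    trans (frobenius pr p≈0 (natF F m)) (+-congˡ (fermat-natF pr p≈0 m))

  neg-natF : ∀ {p} → Prime p → natF F p ≈ 0# → ∀ m → - natF F m ≈ natF F ((p ∸ 1) ℕ.* m)
  neg-natF {suc n} _ p≈0 m = sym (inverseʳ-unique (natF F m) (natF F (n ℕ.* m))
    (trans (sym (natF-+ m (n ℕ.* m))) (natF-vanish p≈0 (suc n ℕ.* m) (ℕD.m∣m*n {suc n} m))))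

  fermat-ι : ∀ {p} → Prime p → natF F p ≈ 0# → ∀ a → ι a ^ p ≈ ι a
  fermat-ι pr p≈0 (+ m) = fermat-natF pr p≈0 m
  fermat-ι {p} pr p≈0 -[1+ m ] = begin
    (- natF F (suc m)) ^ p       ≈⟨ ^-congˡ p (neg-natF pr p≈0 (suc m)) ⟩
    natF F ((p ∸ 1) ℕ.* suc m) ^ p ≈⟨ fermat-natF pr p≈0 ((p ∸ 1) ℕ.* suc m) ⟩
    natF F ((p ∸ 1) ℕ.* suc m)     ≈⟨ sym (neg-natF pr p≈0 (suc m)) ⟩
    - natF F (suc m)             ∎

  module _ {p : ℕ} (ch : HasCharacteristic F p) where
    private
      p≈0 = proj₁ (proj₂ ch)
      instance
        p≢0 : ℕ.NonZero p
        p≢0 = ℕ.>-nonZero (proj₁ ch)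

    natF≈0⇒p∣ : ∀ m → natF F m ≈ 0# → p ∣ m
    natF≈0⇒p∣ m m≈0 with m % p in m%p≡r
    ... | zero = ℕD.m%n≡0⇒n∣m m p m%p≡r
    ... | suc r = ⊥-elim (proj₂ (proj₂ ch) (suc r) (s≤s z≤n)
                    (≡.subst (_< p) m%p≡r (m%n<n m p)) remainder≈0)
      where
        remainder≈0 : natF F (suc r) ≈ 0#
        remainder≈0 = begin
          natF F (suc r)                       ≈⟨ sym (+-identityʳ _) ⟩
          natF F (suc r) + 0#                  ≈⟨ +-congˡ (sym (natF-vanish p≈0 _ (ℕD.n∣m*n (m / p)))) ⟩
          natF F (suc r) + natF F (m / p ℕ.* p)  ≈⟨ sym (natF-+ (suc r) _) ⟩
          natF F (suc r ℕ.+ m / p ℕ.* p)         ≡⟨ ≡.cong (λ k → natF F (k ℕ.+ m / p ℕ.* p)) (≡.sym m%p≡r) ⟩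
          natF F (m % p ℕ.+ m / p ℕ.* p)         ≡⟨ ≡.cong (natF F) (≡.sym (m≡m%n+[m/n]*n m p)) ⟩
          natF F m                             ≈⟨ m≈0 ⟩
          0#                                   ∎

    ι≈0⇒p∣ : ∀ a → ι a ≈ 0# → p ∣ ℤ.∣ a ∣
    ι≈0⇒p∣ (+ m) = natF≈0⇒p∣ m
    ι≈0⇒p∣ -[1+ m ] -m≈0 = natF≈0⇒p∣ (suc m)
      (trans (sym (⁻¹-involutive _)) (trans (-‿cong -m≈0) ε⁻¹≈ε))

  ι-power≈1 : ∀ {p} → Prime p → IsFiniteField F → HasCharacteristic F p →
              ∀ a → ¬ (p ∣ ℤ.∣ a ∣) → ∀ g → (p ∸ 1) ∣ g → ι a ^ g ≈ 1#
  ι-power≈1 {p} pr ff ch a p∤a g p-1∣g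
    with IsFiniteField.inverses ff (ι a) (p∤a ∘ ι≈0⇒p∣ ch a)
  ... | y , ay≈1 = power-multiple (ι a) (p ∸ 1) g
        (unit-power p (ι a) y (fermat-ι pr (proj₁ (proj₂ ch)) a) ay≈1) p-1∣g

module ValueAt01 {c₀ ℓ} (F : CommutativeRing c₀ ℓ) where
  open CommutativeRing F
  open import Relation.Binary.Reasoning.Setoid setoid
  open import Algebra.Properties.Semiring.Exp semiring using (_^_)
  open import Algebra.Properties.AbelianGroup +-abelianGroup using (ε⁻¹≈ε)
  open import Algebra.Properties.Monoid.Sum +-monoid using (sum)
  open Poly F
  open CharacteristicP F using (ι; sum-zero)

  -- The coefficient of Y^n of a form of degree n, i.e. its value at (0,1);
  -- it is a ring homomorphism on coefficient lists.
  c0 : List Carrier → Carrier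
  c0 l = coeffAt l 0

  c0-⊕ : ∀ l m → c0 (l ⊕ m) ≈ c0 l + c0 m
  c0-⊕ [] m = sym (+-identityˡ _)
  c0-⊕ (x ∷ l) [] = sym (+-identityʳ _)
  c0-⊕ (x ∷ l) (y ∷ m) = refl

  c0-scale : ∀ x l → c0 (List.map (x *_) l) ≈ x * c0 l
  c0-scale x [] = sym (zeroʳ x)
  c0-scale x (y ∷ l) = refl

  c0-⊛ : ∀ l m → c0 (l ⊛ m) ≈ c0 l * c0 m
  c0-⊛ [] m = sym (zeroˡ _)
  c0-⊛ (x ∷ l) m =
    trans (c0-⊕ (List.map (x *_) m) (0# ∷ (l ⊛ m))) (trans (+-identityʳ _) (c0-scale x m))

  c0-pow : ∀ L n → c0 (pow L n) ≈ c0 L ^ n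
  c0-pow L zero = refl
  c0-pow L (suc n) = trans (c0-⊛ L (pow L n)) (*-congˡ (c0-pow L n))

  c0-sumFin : ∀ {n} (f : Fin n → List Carrier) → c0 (sumFin f) ≈ sum (c0 ∘ f)
  c0-sumFin {zero} f = refl
  c0-sumFin {suc n} f =
    trans (c0-⊕ (f Fin.zero) (sumFin (f ∘ Fin.suc))) (+-congˡ (c0-sumFin (f ∘ Fin.suc)))

  c0-monomial : ∀ x L₁ L₂ k m →
    c0 (List.map (x *_) (pow L₁ k ⊛ pow L₂ m)) ≈ x * (c0 L₁ ^ k * c0 L₂ ^ m)
  c0-monomial x L₁ L₂ k m = trans (c0-scale x (pow L₁ k ⊛ pow L₂ m))
    (*-congˡ (trans (c0-⊛ (pow L₁ k) (pow L₂ m)) (*-cong (c0-pow L₁ k) (c0-pow L₂ m))))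

  -- (P|γ)(0,1) = P(-c, a), which is a^g · P(0,1) when c = 0 in F.
  act-at-01 : ∀ g P γ → ι (c γ) ≈ 0# → ev01 g (act g P γ) ≈ ev01 g P * ι (a γ) ^ g
  act-at-01 g P γ c≈0 = begin
    ev01 g (act g P γ)                      ≈⟨ c0-sumFin term ⟩
    c0 (term Fin.zero) + sum (c0 ∘ term ∘ Fin.suc) ≈⟨ +-congˡ (sum-zero _ higher≈0) ⟩
    c0 (term Fin.zero) + 0#                 ≈⟨ +-identityʳ _ ⟩
    c0 (term Fin.zero)                      ≈⟨ c0-monomial (P Fin.zero) L₁ L₂ 0 g ⟩
    P Fin.zero * (1# * ι (a γ) ^ g)         ≈⟨ *-congˡ (*-identityˡ _) ⟩
    P Fin.zero * ι (a γ) ^ g                ∎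
    where
      L₁ = lin (ι (d γ)) (- ι (c γ))
      L₂ = lin (- ι (b γ)) (ι (a γ))
      term : Fin (suc g) → List Carrier
      term i = List.map (P i *_) (pow L₁ (toℕ i) ⊛ pow L₂ (g ∸ toℕ i))
      -- every monomial containing X, i.e. a factor L₁, vanishes at (0,1)
      higher≈0 : ∀ i → c0 (term (Fin.suc i)) ≈ 0#
      higher≈0 i = begin
        c0 (term (Fin.suc i))
          ≈⟨ c0-monomial (P (Fin.suc i)) L₁ L₂ (suc (toℕ i)) (g ∸ suc (toℕ i)) ⟩
        P (Fin.suc i) * ((- ι (c γ) * c0 L₁ ^ toℕ i) * c0 L₂ ^ (g ∸ suc (toℕ i)))
          ≈⟨ *-congˡ (*-congʳ (*-congʳ (trans (-‿cong c≈0) ε⁻¹≈ε))) ⟩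
        P (Fin.suc i) * ((0# * c0 L₁ ^ toℕ i) * c0 L₂ ^ (g ∸ suc (toℕ i)))
          ≈⟨ *-congˡ (trans (*-congʳ (zeroˡ _)) (zeroˡ _)) ⟩
        P (Fin.suc i) * 0#
          ≈⟨ zeroʳ _ ⟩
        0# ∎

Γ₀-mono : ∀ {M M'} → M' ∣ M → ∀ γ → Γ₀ M γ → Γ₀ M' γ
Γ₀-mono M'∣M γ (det≡1 , M∣c) = det≡1 , ℕD.∣-trans M'∣M M∣c

-- Γ₀(M) ⊆ S₀(p) for a prime p ∣ M: from p ∣ c and ad - bc = 1, p ∤ a.
Γ₀⊆S₀ : ∀ {p M} → Prime p → p ∣ M → ∀ γ → Γ₀ M γ → S₀ p γ
Γ₀⊆S₀ {p} pr p∣M γ (det≡1 , M∣c) = det≢0 , p∣c , p∤a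
  where
    det≢0 : det γ ≢ + 0
    det≢0 det≡0 with ≡.trans (≡.sym det≡1) det≡0
    ... | ()
    p∣c = ℕD.∣-trans p∣M M∣c
    p∤a : ¬ (p ∣ ℤ.∣ a γ ∣)
    p∤a p∣a = prime∤1 pr (≡.subst (λ z → p ∣ ℤ.∣ z ∣) det≡1 (ℤD.∣⇒∣ᵤ {+ p}
      (ℤD.∣m∣n⇒∣m-n (ℤD.∣m⇒∣m*n (d γ) (ℤD.∣ᵤ⇒∣ {+ p} {a γ} p∣a))
                    (ℤD.∣n⇒∣m*n (b γ) (ℤD.∣ᵤ⇒∣ {+ p} {c γ} p∣c)))))

upperRep : ℕ → ℕ → Mat
upperRep l k = mat (+ 1) (+ k) (+ 0) (+ l)

diagRep : ℕ → Mat
diagRep l = mat (+ l) (+ 0) (+ 0) (+ 1)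

upperReps : ℕ → List Mat
upperReps l = List.map (upperRep l) (List.upTo l)

det≡pos⇒≢0 : ∀ {l} γ → 0 < l → det γ ≡ + l → det γ ≢ + 0
det≡pos⇒≢0 γ 0<l det≡l det≡0 =
  ℕP.<⇒≢ 0<l (≡.sym (ℤP.+-injective (≡.trans (≡.sym det≡l) det≡0)))

upperRep∈S₀ : ∀ {p l} → Prime p → 0 < l → ∀ k → S₀ p (upperRep l k)
upperRep∈S₀ {p} {l} pr 0<l k = det≡pos⇒≢0 (upperRep l k) 0<l det≡l , p ℕD.∣0 , prime∤1 pr
  where
    det≡l : det (upperRep l k) ≡ + l
    det≡l rewrite ℤP.*-identityˡ (+ l) | ℤP.*-zeroʳ (+ k) = ℤP.+-identityʳ (+ l)

diagRep∈S₀ : ∀ {p l} → 0 < l → ¬ (p ∣ l) → S₀ p (diagRep l)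
diagRep∈S₀ {p} {l} 0<l p∤l = det≡pos⇒≢0 (diagRep l) 0<l det≡l , p ℕD.∣0 , p∤l
  where
    det≡l : det (diagRep l) ≡ + l
    det≡l rewrite ℤP.*-identityʳ (+ l) = ℤP.+-identityʳ (+ l)

module Representatives {c₀ ℓ} (C : Coeff c₀ ℓ) where
  open Coh C

  heckeReps-∣ : ∀ L l → l ∣ L → heckeReps L l ≡ upperReps l ++ []
  heckeReps-∣ L l l∣L with l ∣? L
  ... | yes _ = ≡.refl
  ... | no l∤L = contradiction l∣L l∤L

  heckeReps-∤ : ∀ L l → ¬ (l ∣ L) → heckeReps L l ≡ upperReps l ++ diagRep l ∷ []
  heckeReps-∤ L l l∤L with l ∣? L
  ... | yes l∣L = contradiction l∣L l∤L
  ... | no _ = ≡.refl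

module Transfer {c₀ ℓ} (F : CommutativeRing c₀ ℓ) (g : ℕ) where
  open CommutativeRing F
  open import Relation.Binary.Reasoning.Setoid setoid
  open Poly F
  module CV = Coh (VgModule g)
  module CF = Coh trivModule
  module RV = Representatives (VgModule g)
  module RF = Representatives trivModule

  ev : Vg g → Carrier
  ev = ev01 g

  transfer-H1c : ∀ {G G' : Mat → Set} → (∀ γ → G' γ → G γ) →
    (∀ γ → G' γ → ∀ P → ev (act g P γ) ≈ ev P) →
    ∀ φ → CV.IsH1c G φ → CF.IsH1c G' (ev ∘ φ)
  transfer-H1c G'⊆G ev-inv φ (additive , congruent , equivariant) =
      (λ D E degD degE → additive D E degD degE Fin.zero)
    , (λ D E degD D≈E → congruent D E degD D≈E Fin.zero)
    , λ γ γ∈G' D degD →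
        trans (sym (ev-inv γ γ∈G' (φ (γ ·D D)))) (equivariant γ (G'⊆G γ γ∈G') D degD Fin.zero)

  S : List Carrier → Carrier
  S = CF.sumM

  ev-sumM : ∀ (vs : List (Vg g)) → ev (CV.sumM vs) ≈ S (List.map ev vs)
  ev-sumM [] = refl
  ev-sumM (v ∷ vs) = +-congˡ (ev-sumM vs)

  S-++ : ∀ {A : Set} (f : A → Carrier) xs ys →
         S (List.map f (xs ++ ys)) ≈ S (List.map f xs) + S (List.map f ys)
  S-++ f [] ys = sym (+-identityˡ _)
  S-++ f (x ∷ xs) ys = trans (+-congˡ (S-++ f xs ys)) (sym (+-assoc _ _ _))

  module HeckeTerms (φ : Div → Vg g) (D : Div) where
    sourceTerm : Mat → Carrier
    sourceTerm δ = ev (act g (φ (δ ·D D)) δ)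

    targetTerm : Mat → Carrier
    targetTerm δ = ev (φ (δ ·D D))

    ev-hecke : ∀ L l → ev (CV.hecke L l φ D) ≈ S (List.map sourceTerm (CV.heckeReps L l))
    ev-hecke L l = begin
      ev (CV.hecke L l φ D)                                    ≈⟨ ev-sumM (List.map action (CV.heckeReps L l)) ⟩
      S (List.map ev (List.map action (CV.heckeReps L l)))    ≡⟨ ≡.cong S (≡.sym (ListP.map-∘ (CV.heckeReps L l))) ⟩
      S (List.map sourceTerm (CV.heckeReps L l))               ∎
      where
        action : Mat → Vg g
        action δ = act g (φ (δ ·D D)) δ

    termwise : ∀ {p} → (∀ γ → S₀ p γ → ∀ P → ev (act g P γ) ≈ ev P) →
               ∀ δs → All (S₀ p) δs → S (List.map sourceTerm δs) ≈ S (List.map targetTerm δs)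
    termwise ev-inv [] [] = refl
    termwise ev-inv (δ ∷ δs) (δ∈S₀ ∷ δs∈S₀) =
      +-cong (ev-inv δ δ∈S₀ (φ (δ ·D D))) (termwise ev-inv δs δs∈S₀)

  hecke-transfer : ∀ {p} → Prime p →
    (∀ γ → S₀ p γ → ∀ P → ev (act g P γ) ≈ ev P) →
    (∀ P → ev (act g P (diagRep p)) ≈ 0#) →
    ∀ N l → Prime l → ∀ φ D → ev (CV.hecke N l φ D) ≈ CF.hecke (N ℕ.* p) l (ev ∘ φ) D
  hecke-transfer {p} pr ev-inv diag≈0 N l lp φ D =
      trans (ev-hecke N l) (compare (l ∣? N) (l ∣? N ℕ.* p))
    where
      open HeckeTerms φ D

      Goal : Set ℓ
      Goal = S (List.map sourceTerm (CV.heckeReps N l)) ≈ S (List.map targetTerm (CF.heckeReps (N ℕ.* p) l))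

      0<l : 0 < l
      0<l = ℕP.<-trans ℕP.0<1+n (prime>1 lp)

      upper∈S₀ : All (S₀ p) (upperReps l)
      upper∈S₀ = AllP.map⁺ (All.universal (upperRep∈S₀ pr 0<l) (List.upTo l))

      share-upper : ∀ {E₁ E₂} →
        CV.heckeReps N l ≡ upperReps l ++ E₁ → CF.heckeReps (N ℕ.* p) l ≡ upperReps l ++ E₂ →
        S (List.map sourceTerm E₁) ≈ S (List.map targetTerm E₂) → Goal
      share-upper {E₁} {E₂} source≡ target≡ extra≈ = begin
        S (List.map sourceTerm (CV.heckeReps N l))   ≡⟨ ≡.cong (S ∘ List.map sourceTerm) source≡ ⟩
        S (List.map sourceTerm (upperReps l ++ E₁))  ≈⟨ S-++ sourceTerm (upperReps l) E₁ ⟩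
        S (List.map sourceTerm (upperReps l)) + S (List.map sourceTerm E₁)
          ≈⟨ +-cong (termwise ev-inv (upperReps l) upper∈S₀) extra≈ ⟩
        S (List.map targetTerm (upperReps l)) + S (List.map targetTerm E₂)
          ≈⟨ sym (S-++ targetTerm (upperReps l) E₂) ⟩
        S (List.map targetTerm (upperReps l ++ E₂))  ≡⟨ ≡.cong (S ∘ List.map targetTerm) (≡.sym target≡) ⟩
        S (List.map targetTerm (CF.heckeReps (N ℕ.* p) l)) ∎

      compare : Dec (l ∣ N) → Dec (l ∣ N ℕ.* p) → Goal
      compare (yes l∣N) _ =
        share-upper (RV.heckeReps-∣ N l l∣N)
                    (RF.heckeReps-∣ (N ℕ.* p) l (ℕD.∣-trans l∣N (ℕD.m∣m*n p))) refl
      compare (no l∤N) (no l∤Np) =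
        share-upper (RV.heckeReps-∤ N l l∤N) (RF.heckeReps-∤ (N ℕ.* p) l l∤Np)
                    (termwise ev-inv (diagRep l ∷ []) (diag∈S₀ ∷ []))
        where
          p∤l : ¬ (p ∣ l)
          p∤l p∣l = l∤Np (≡.subst (_∣ N ℕ.* p) (prime∣prime⇒≡ pr lp p∣l) (ℕD.n∣m*n N))
          diag∈S₀ = diagRep∈S₀ 0<l p∤l
      -- l ∣ Np but l ∤ N forces l = p: T_p has the extra term (p 0; 0 1), which vanishes.
      compare (no l∤N) (yes l∣Np) with euclidsLemma N p lp l∣Np
      ... | inj₁ l∣N = contradiction l∣N l∤N
      ... | inj₂ l∣p =
        share-upper (RV.heckeReps-∤ N l l∤N) (RF.heckeReps-∣ (N ℕ.* p) l l∣Np)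
          (≡.subst (λ q → sourceTerm (diagRep q) + 0# ≈ 0#) (≡.sym (prime∣prime⇒≡ lp pr l∣p))
                   (trans (+-identityʳ _) (diag≈0 (φ (diagRep p ·D D)))))

module Equivariance {c₀ ℓ} (F : CommutativeRing c₀ ℓ) where
  open CommutativeRing F
  open import Algebra.Properties.Semiring.Exp semiring using (_^_)
  open Poly F
  open import Relation.Binary.Reasoning.Setoid setoid
  open CharacteristicP F using (ι; ι-vanish; ι-power≈1)
  open ValueAt01 F using (act-at-01)

  -- P(0,1) is S₀(p)-invariant: (P|γ)(0,1) = a^g · P(0,1) and a^g = 1.
  ev01-S₀-invariant : ∀ {p} → Prime p → IsFiniteField F → HasCharacteristic F p →
    ∀ g → (p ∸ 1) ∣ g → ∀ γ → S₀ p γ → ∀ P → ev01 g (act g P γ) ≈ ev01 g P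
  ev01-S₀-invariant {p} pr ff ch g p-1∣g γ (_ , p∣c , p∤a) P = begin
    ev01 g (act g P γ)            ≈⟨ act-at-01 g P γ (ι-vanish (proj₁ (proj₂ ch)) (c γ) p∣c) ⟩
    ev01 g P * ι (a γ) ^ g        ≈⟨ *-congˡ (ι-power≈1 pr ff ch (a γ) p∤a g p-1∣g) ⟩
    ev01 g P * 1#                 ≈⟨ *-identityʳ _ ⟩
    ev01 g P                      ∎

  -- The representative (p 0; 0 1) kills P(0,1): (P|δ)(0,1) = p^g · P(0,1) = 0.
  ev01-diagRep-vanish : ∀ {p} → natF F p ≈ 0# → ∀ g → 0 < g → ∀ P →
    ev01 g (act g P (diagRep p)) ≈ 0#
  ev01-diagRep-vanish {p} p≈0 (suc g) _ P =
    trans (act-at-01 (suc g) P (diagRep p) refl)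
      (trans (*-congˡ (trans (*-congʳ p≈0) (zeroˡ _))) (zeroʳ _))

-- ℕ multiplication is opened only here, for the statement: above, _*_ is the
-- ring multiplication of F.
open import Data.Nat using (_*_)

lemma4p4 : ∀ {c ℓ} (p : ℕ) → Prime p → p ≢ 2 →
  (N : ℕ) → 0 < N → ¬ (p ∣ N) →
  (g : ℕ) → 0 < g → (p ∸ 1) ∣ g →
  (F : CommutativeRing c ℓ) → IsFiniteField F → HasCharacteristic F p →
  let open CommutativeRing F using (_≈_)
      open Poly F
      module CV = Coh (VgModule g)
      module CF = Coh trivModule
      α : (Div → Vg g) → (Div → CommutativeRing.Carrier F)
      α φ D = ev01 g (φ D)
  in (∀ γ → S₀ p γ → ∀ P → ev01 g (act g P γ) ≈ ev01 g P)
     × (∀ φ → CV.IsH1c (Γ₀ N) φ →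
          CF.IsH1c (Γ₀ (N * p)) (α φ)
          × (∀ l → Prime l → ∀ D → deg D ≡ + 0 →
               α (CV.hecke N l φ) D ≈ CF.hecke (N * p) l (α φ) D))
lemma4p4 p pr _ N _ _ g 0<g p-1∣g F ff ch =
    ev-invariant
  , λ φ φ-cocycle →
        transfer-H1c (Γ₀-mono (ℕD.m∣m*n {N} p))
          (λ γ γ∈Γ₀Np → ev-invariant γ (Γ₀⊆S₀ pr (ℕD.n∣m*n N) γ γ∈Γ₀Np)) φ φ-cocycle
      , λ l lp D _ → hecke-transfer pr ev-invariant diag≈0 N l lp φ D
  where
    open CommutativeRing F using (_≈_; 0#)
    open Poly F using (act)
    open Equivariance F
    open Transfer F g
    ev-invariant : ∀ γ → S₀ p γ → ∀ P → ev (act g P γ) ≈ ev P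
    ev-invariant = ev01-S₀-invariant pr ff ch g p-1∣g
    diag≈0 : ∀ P → ev (act g P (diagRep p)) ≈ 0#
    diag≈0 = ev01-diagRep-vanish {p} (proj₁ (proj₂ ch)) g 0<g
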